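{- Let $D$ be a finite simple digraph in which every vertex has out-degree at least $1$. Then either there exists a vertex $v$ such that $\phi(D-v)\le\phi(D)$ and every vertex of $D-v$ has out-degree at least $1$ in $D-v$, or every vertex of $D$ has in-degree exactly $1$ and out-degree exactly $1$ (i.e. $D$ is a vertex-disjoint union of directed cycles). Here for a digraph $H$, $\phi(H)=\sum_{u\in V(H)}\frac{1}{\deg^+_H(u)+1}$.
   Context: $\deg^+_H(u)$ is the out-degree of $u$ in $H$; $D-v$ is obtained by deleting $v$ and all edges incident to it. A simple digraph has no loops and no parallel edges. -}

module Defs where

open import Data.Nat using (ℕ; zero; suc; pred)
open import Data.Bool using (Bool; true; false; if_then_else_)
open import Data.Fin using (Fin; punchIn)
open import Data.List using (List; map; foldr; allFin)
open import Data.Nat.ListAction using (sum)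
open import Data.Integer using (+_)
open import Data.Rational using (ℚ; 0ℚ; _+_; _/_)
open import Relation.Binary.PropositionalEquality using (_≡_)

-- A finite simple digraph on vertex set Fin n: the arc relation is a
-- Bool-valued relation (so no parallel arcs), and there are no loops.
record Digraph (n : ℕ) : Set where
  field
    arc      : Fin n → Fin n → Bool
    loopless : ∀ v → arc v v ≡ false
open Digraph public

countV : ∀ {n} → (Fin n → Bool) → ℕ
countV {n} p = sum (map (λ w → if p w then 1 else 0) (allFin n))

outdeg : ∀ {n} → Digraph n → Fin n → ℕ
outdeg D u = countV (λ w → arc D u w)

indeg : ∀ {n} → Digraph n → Fin n → ℕ
indeg D u = countV (λ w → arc D w u)

delete : ∀ {n} → Digraph n → Fin n → Digraph (pred n)
delete {suc m} D v = record
  { arc      = λ x y → arc D (punchIn v x) (punchIn v y)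
  ; loopless = λ x → loopless D (punchIn v x) }

φ : ∀ {n} → Digraph n → ℚ
φ {n} H = foldr _+_ 0ℚ (map (λ u → (+ 1) / suc (outdeg H u)) (allFin n))

{-# OPTIONS --safe #-}
-- A vertex u of out-degree d spreads 1/(d+1) evenly over its out-arcs, so each of its
-- arcs carries 1/d − 1/(d+1).  Deleting v lowers the out-degree of every in-neighbour u
-- of v by one, which raises u's term of φ by exactly the weight of the arc u → v; hence
-- φ(D − v) = φ(D) − 1/(d⁺(v)+1) + gain(v), where gain(v) is the weight entering v.  So v
-- can be deleted when gain(v) ≤ 1/(d⁺(v)+1) and v is not the only out-neighbour of some
-- vertex.  Otherwise every v has gain(v) ≥ 1/(d⁺(v)+1) (an arc from a vertex of out-degree
-- 1 alone carries 1/2), strictly unless v has in- and out-degree 1.  Since the gains sum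
-- to φ(D) = Σ 1/(d⁺(v)+1), all these inequalities are equalities.
module Submission where

open import Defs
open import Data.Nat using (ℕ; _≥_; pred)
open import Data.Fin using (Fin)
open import Data.Product using (Σ; _×_)
open import Data.Sum using (_⊎_)
open import Data.Rational using (_≤_)
open import Relation.Binary.PropositionalEquality using (_≡_)

open import Data.Bool using (Bool; true; false; if_then_else_)
import Data.Bool.Properties as BoolP
open import Data.Empty using (⊥-elim)
open import Data.Fin as Fin using (punchIn)
open import Data.Fin.Properties using (any?)
open import Data.Integer as ℤ using (ℤ)
import Data.Integer.Properties as ℤP
open import Data.Integer.Tactic.RingSolver using (solve-∀)
open import Data.List as List using (allFin; tabulate)
import Data.List.Properties as ListP
open import Data.Nat as ℕ using (zero; suc; s≤s; z≤n)
import Data.Nat.Properties as ℕP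
open import Data.Product as Product using (_,_; ∃)
open import Data.Rational as ℚ using (ℚ; 0ℚ; 1ℚ; _+_; _-_; _/_; _<_; toℚᵘ)
import Data.Rational.Properties as QP
open import Data.Rational.Solver using (module +-*-Solver)
open import Data.Rational.Unnormalised as ℚᵘ using (mkℚᵘ; _≃_)
import Data.Rational.Unnormalised.Properties as ℚᵘP
open import Data.Sum using (inj₁; inj₂)
import Data.Vec.Functional as Vector
open import Function using (id; _∘_; case_of_)
open import Relation.Binary.PropositionalEquality
  using (refl; sym; trans; cong; cong₂; subst; subst₂; _≢_; module ≡-Reasoning)
open import Relation.Nullary using (¬_; Dec; yes; no)
open import Relation.Nullary.Decidable using (_×-dec_; ¬?; decidable-stable)

open import Algebra.Properties.CommutativeMonoid.Mult QP.+-0-commutativeMonoid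
  using () renaming (_×_ to _·_)
open import Algebra.Properties.CommutativeMonoid.Sum QP.+-0-commutativeMonoid
  using (sum; sum-syntax; sum-remove; sum-cong-≗; sum-replicate-zero; ∑-distrib-+; ∑-comm)
import Algebra.Properties.CommutativeMonoid.Sum ℕP.+-0-commutativeMonoid as Σℕ

indicator : Bool → ℕ
indicator b = if b then 1 else 0

inv-suc : ℕ → ℚ
inv-suc k = ℤ.+ 1 / suc k

toℚᵘ-inv-suc : ∀ k → toℚᵘ (inv-suc k) ≃ mkℚᵘ (ℤ.+ 1) k
toℚᵘ-inv-suc k = QP.toℚᵘ-fromℚᵘ (mkℚᵘ (ℤ.+ 1) k)

inv-suc-anti-< : ∀ {m n} → m ℕ.< n → inv-suc n < inv-suc m
inv-suc-anti-< {m} {n} m<n = QP.toℚᵘ-cancel-<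
  (ℚᵘP.<-respˡ-≃ (ℚᵘP.≃-sym (toℚᵘ-inv-suc n)) (ℚᵘP.<-respʳ-≃ (ℚᵘP.≃-sym (toℚᵘ-inv-suc m))
    (ℚᵘ.*<* (subst₂ ℤ._<_ (sym (ℤP.*-identityˡ _)) (sym (ℤP.*-identityˡ _)) (ℤ.+<+ (s≤s m<n))))))

inv-suc-anti-≤ : ∀ {m n} → m ℕ.≤ n → inv-suc n ≤ inv-suc m
inv-suc-anti-≤ {m} {n} m≤n = QP.toℚᵘ-cancel-≤
  (ℚᵘP.≤-respˡ-≃ (ℚᵘP.≃-sym (toℚᵘ-inv-suc n)) (ℚᵘP.≤-respʳ-≃ (ℚᵘP.≃-sym (toℚᵘ-inv-suc m))
    (ℚᵘ.*≤* (subst₂ ℤ._≤_ (sym (ℤP.*-identityˡ _)) (sym (ℤP.*-identityˡ _)) (ℤ.+≤+ (s≤s m≤n))))))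

toℚᵘ-·-inv-suc : ∀ n k → toℚᵘ (n · inv-suc k) ≃ mkℚᵘ (ℤ.+ n) k
toℚᵘ-·-inv-suc zero    k = ℚᵘ.*≡* refl
toℚᵘ-·-inv-suc (suc n) k = begin
  toℚᵘ (inv-suc k + n · inv-suc k)           ≈⟨ QP.toℚᵘ-homo-+ (inv-suc k) (n · inv-suc k) ⟩
  toℚᵘ (inv-suc k) ℚᵘ.+ toℚᵘ (n · inv-suc k) ≈⟨ ℚᵘP.+-cong (toℚᵘ-inv-suc k) (toℚᵘ-·-inv-suc n k) ⟩
  mkℚᵘ (ℤ.+ 1) k ℚᵘ.+ mkℚᵘ (ℤ.+ n) k         ≈⟨ ℚᵘ.*≡* (add-numerators (ℤ.+ n) (ℤ.+ suc k)) ⟩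
  mkℚᵘ (ℤ.+ suc n) k                         ∎
  where
  open ℚᵘP.≃-Reasoning
  add-numerators : ∀ (n s : ℤ) → (ℤ.1ℤ ℤ.* s ℤ.+ n ℤ.* s) ℤ.* s ≡ (ℤ.1ℤ ℤ.+ n) ℤ.* (s ℤ.* s)
  add-numerators = solve-∀

·-inv-suc : ∀ k → suc k · inv-suc k ≡ 1ℚ
·-inv-suc k = QP.toℚᵘ-injective
  (ℚᵘP.≃-trans (toℚᵘ-·-inv-suc (suc k) k) (ℚᵘ.*≡* (ℤP.*-comm (ℤ.+ suc k) (ℤ.+ 1))))

open +-*-Solver

·-distrib-- : ∀ n p q → n · (p - q) ≡ n · p - n · q
·-distrib-- zero    p q = refl
·-distrib-- (suc n) p q = trans (cong ((p - q) +_) (·-distrib-- n p q))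
  (solve 4 (λ p q np nq → (p :- q) :+ (np :- nq) := (p :+ np) :- (q :+ nq)) refl p q (n · p) (n · q))

arc-weight : ℕ → ℚ
arc-weight zero    = 0ℚ
arc-weight (suc k) = inv-suc k - inv-suc (suc k)

·-arc-weight : ∀ {d} → d ≥ 1 → d · arc-weight d ≡ inv-suc d
·-arc-weight {suc k} _ = begin
  suc k · (inv-suc k - inv-suc (suc k))  ≡⟨ ·-distrib-- (suc k) (inv-suc k) (inv-suc (suc k)) ⟩
  suc k · inv-suc k - X                  ≡⟨ cong (_- X) (trans (·-inv-suc k) (sym (·-inv-suc (suc k)))) ⟩
  (inv-suc (suc k) + X) - X              ≡⟨ solve 2 (λ y x → (y :+ x) :- x := y) refl (inv-suc (suc k)) X ⟩
  inv-suc (suc k)                        ∎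
  where
  open ≡-Reasoning
  X = suc k · inv-suc (suc k)

inv-suc-split-indicator : ∀ b k →
  inv-suc k ≡ inv-suc (indicator b ℕ.+ k) + (if b then arc-weight (indicator b ℕ.+ k) else 0ℚ)
inv-suc-split-indicator true  k = solve 2 (λ x y → x := y :+ (x :- y)) refl (inv-suc k) (inv-suc (suc k))
inv-suc-split-indicator false k = sym (QP.+-identityʳ (inv-suc k))

arc-weight-pos : ∀ {d} → d ≥ 1 → 0ℚ < arc-weight d
arc-weight-pos {suc k} _ = begin-strict
  0ℚ             ≡⟨ QP.+-inverseʳ y ⟨
  y - y          <⟨ QP.+-monoˡ-< (ℚ.- y) (inv-suc-anti-< (ℕP.n<1+n k)) ⟩
  inv-suc k - y  ∎
  where
  open QP.≤-Reasoning
  y = inv-suc (suc k)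

arc-weight-nonNeg : ∀ d → 0ℚ ≤ arc-weight d
arc-weight-nonNeg zero    = QP.≤-refl
arc-weight-nonNeg (suc k) = QP.<⇒≤ (arc-weight-pos {suc k} (s≤s z≤n))

foldr-tabulate : ∀ {A B : Set} (_∙_ : A → B → B) e {n} (f : Fin n → A) →
                 List.foldr _∙_ e (tabulate f) ≡ Vector.foldr _∙_ e f
foldr-tabulate _∙_ e {zero}  f = refl
foldr-tabulate _∙_ e {suc n} f = cong (f Fin.zero ∙_) (foldr-tabulate _∙_ e (f ∘ Fin.suc))

foldr-map-allFin : ∀ {A B : Set} (_∙_ : A → B → B) e {n} (f : Fin n → A) →
                   List.foldr _∙_ e (List.map f (allFin n)) ≡ Vector.foldr _∙_ e f
foldr-map-allFin _∙_ e f = trans (cong (List.foldr _∙_ e) (ListP.map-tabulate id f)) (foldr-tabulate _∙_ e f)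

countV≡sum : ∀ {n} (p : Fin n → Bool) → countV p ≡ Σℕ.sum (indicator ∘ p)
countV≡sum p = foldr-map-allFin ℕ._+_ 0 (indicator ∘ p)

φ≡sum : ∀ {n} (H : Digraph n) → φ H ≡ ∑[ u < n ] inv-suc (outdeg H u)
φ≡sum H = foldr-map-allFin _+_ 0ℚ (inv-suc ∘ outdeg H)

countV-remove : ∀ {n} (p : Fin (suc n) → Bool) v → countV p ≡ indicator (p v) ℕ.+ countV (p ∘ punchIn v)
countV-remove p v = begin
  countV p                                                 ≡⟨ countV≡sum p ⟩
  Σℕ.sum (indicator ∘ p)                                   ≡⟨ Σℕ.sum-remove (indicator ∘ p) ⟩
  indicator (p v) ℕ.+ Σℕ.sum (indicator ∘ p ∘ punchIn v)   ≡⟨ cong (indicator (p v) ℕ.+_) (countV≡sum (p ∘ punchIn v)) ⟨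
  indicator (p v) ℕ.+ countV (p ∘ punchIn v)               ∎
  where open ≡-Reasoning

countV≢0⇒∃ : ∀ {n} (p : Fin n → Bool) → countV p ≢ 0 → ∃ λ w → p w ≡ true
countV≢0⇒∃ {zero}  p count≢0 = ⊥-elim (count≢0 refl)
countV≢0⇒∃ {suc n} p count≢0 with p Fin.zero in p0 | countV-remove p Fin.zero
... | true  | _      = Fin.zero , p0
... | false | count≡ = Product.map Fin.suc id (countV≢0⇒∃ (p ∘ Fin.suc) (count≢0 ∘ trans count≡))

sum-if : ∀ {n} (p : Fin n → Bool) q → ∑[ i < n ] (if p i then q else 0ℚ) ≡ countV p · q
sum-if {zero}  p q = refl
sum-if {suc n} p q with p Fin.zero | countV-remove p Fin.zero
... | true  | count≡ = trans (cong (q +_) (sum-if (p ∘ Fin.suc) q)) (cong (_· q) (sym count≡))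
... | false | count≡ = trans (QP.+-identityˡ _) (trans (sum-if (p ∘ Fin.suc) q) (cong (_· q) (sym count≡)))

sum-mono-≤ : ∀ {n} {f g : Fin n → ℚ} → (∀ i → f i ≤ g i) → sum f ≤ sum g
sum-mono-≤ {zero}  f≤g = QP.≤-refl
sum-mono-≤ {suc n} f≤g = QP.+-mono-≤ (f≤g Fin.zero) (sum-mono-≤ (f≤g ∘ Fin.suc))

sum-mono-< : ∀ {n} {f g : Fin n → ℚ} → (∀ i → f i ≤ g i) → ∀ i → f i < g i → sum f < sum g
sum-mono-< f≤g Fin.zero    fi<gi = QP.+-mono-<-≤ fi<gi (sum-mono-≤ (f≤g ∘ Fin.suc))
sum-mono-< f≤g (Fin.suc i) fi<gi = QP.+-mono-≤-< (f≤g Fin.zero) (sum-mono-< (f≤g ∘ Fin.suc) i fi<gi)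

sum-nonNeg : ∀ {n} {f : Fin n → ℚ} → (∀ i → 0ℚ ≤ f i) → 0ℚ ≤ sum f
sum-nonNeg {n} 0≤f = QP.≤-trans (QP.≤-reflexive (sym (sum-replicate-zero n))) (sum-mono-≤ 0≤f)

term≤sum : ∀ {n} {f : Fin n → ℚ} → (∀ i → 0ℚ ≤ f i) → ∀ i → f i ≤ sum f
term≤sum {suc n} {f} 0≤f i = begin
  f i                        ≡⟨ QP.+-identityʳ (f i) ⟨
  f i + 0ℚ                   ≤⟨ QP.+-monoʳ-≤ (f i) (sum-nonNeg (0≤f ∘ punchIn i)) ⟩
  f i + sum (f ∘ punchIn i)  ≡⟨ sum-remove f ⟨
  sum f                      ∎
  where open QP.≤-Reasoning

module _ {m : ℕ} (D : Digraph (suc m)) where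

  share : Fin (suc m) → Fin (suc m) → ℚ
  share u v = if arc D u v then arc-weight (outdeg D u) else 0ℚ

  gain : Fin (suc m) → ℚ
  gain v = ∑[ u < suc m ] share u v

  others : Fin (suc m) → ℚ
  others v = ∑[ x < m ] inv-suc (outdeg D (punchIn v x))

  arc⇒outdeg≥1 : ∀ {u v} → arc D u v ≡ true → outdeg D u ≥ 1
  arc⇒outdeg≥1 {u} {v} uv = subst (_≥ 1) (sym (countV-remove (arc D u) v)) 1+c≥1
    where
    1+c≥1 : indicator (arc D u v) ℕ.+ countV (arc D u ∘ punchIn v) ≥ 1
    1+c≥1 rewrite uv = s≤s z≤n

  share-arc : ∀ {u v} → arc D u v ≡ true → share u v ≡ arc-weight (outdeg D u)
  share-arc uv rewrite uv = refl

  share-pos : ∀ {u v} → arc D u v ≡ true → 0ℚ < share u v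
  share-pos uv = subst (0ℚ <_) (sym (share-arc uv)) (arc-weight-pos (arc⇒outdeg≥1 uv))

  share-nonNeg : ∀ u v → 0ℚ ≤ share u v
  share-nonNeg u v with arc D u v
  ... | true  = arc-weight-nonNeg (outdeg D u)
  ... | false = QP.≤-refl

  share-self : ∀ v → share v v ≡ 0ℚ
  share-self v rewrite loopless D v = refl

  outdeg-delete : ∀ v x → outdeg D (punchIn v x) ≡ indicator (arc D (punchIn v x) v) ℕ.+ outdeg (delete D v) x
  outdeg-delete v x = countV-remove (arc D (punchIn v x)) v

  inv-suc-outdeg-delete : ∀ v x →
    inv-suc (outdeg (delete D v) x) ≡ inv-suc (outdeg D (punchIn v x)) + share (punchIn v x) v
  inv-suc-outdeg-delete v x = trans (inv-suc-split-indicator (arc D (punchIn v x) v) (outdeg (delete D v) x))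
    (cong (λ d → inv-suc d + (if arc D (punchIn v x) v then arc-weight d else 0ℚ)) (sym (outdeg-delete v x)))

  gain-remove : ∀ v → gain v ≡ ∑[ x < m ] share (punchIn v x) v
  gain-remove v = trans (sum-remove {i = v} (λ u → share u v))
    (trans (cong (_+ rest) (share-self v)) (QP.+-identityˡ rest))
    where rest = ∑[ x < m ] share (punchIn v x) v

  φ-delete : ∀ v → φ (delete D v) ≡ others v + gain v
  φ-delete v = begin
    φ (delete D v)                                                         ≡⟨ φ≡sum (delete D v) ⟩
    ∑[ x < m ] inv-suc (outdeg (delete D v) x)                             ≡⟨ sum-cong-≗ (inv-suc-outdeg-delete v) ⟩
    ∑[ x < m ] (inv-suc (outdeg D (punchIn v x)) + share (punchIn v x) v)  ≡⟨ ∑-distrib-+ _ shares ⟩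
    others v + ∑[ x < m ] share (punchIn v x) v                            ≡⟨ cong (others v +_) (gain-remove v) ⟨
    others v + gain v                                                      ∎
    where
    open ≡-Reasoning
    shares : Fin m → ℚ
    shares x = share (punchIn v x) v

  φ-remove : ∀ v → φ D ≡ inv-suc (outdeg D v) + others v
  φ-remove v = trans (φ≡sum D) (sum-remove {i = v} (inv-suc ∘ outdeg D))

  φ-delete-≤ : ∀ v → gain v ≤ inv-suc (outdeg D v) → φ (delete D v) ≤ φ D
  φ-delete-≤ v gain≤ = begin
    φ (delete D v)                  ≡⟨ φ-delete v ⟩
    others v + gain v               ≤⟨ QP.+-monoʳ-≤ (others v) gain≤ ⟩
    others v + inv-suc (outdeg D v) ≡⟨ QP.+-comm (others v) _ ⟩
    inv-suc (outdeg D v) + others v ≡⟨ φ-remove v ⟨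
    φ D                             ∎
    where open QP.≤-Reasoning

  ∑share≡inv-suc : ∀ u → outdeg D u ≥ 1 → ∑[ v < suc m ] share u v ≡ inv-suc (outdeg D u)
  ∑share≡inv-suc u d≥1 = trans (sum-if (arc D u) (arc-weight (outdeg D u))) (·-arc-weight d≥1)

  ∑gain≡φ : (∀ u → outdeg D u ≥ 1) → ∑[ v < suc m ] gain v ≡ φ D
  ∑gain≡φ d≥1 = begin
    ∑[ v < suc m ] ∑[ u < suc m ] share u v   ≡⟨ ∑-comm share ⟨
    ∑[ u < suc m ] ∑[ v < suc m ] share u v   ≡⟨ sum-cong-≗ (λ u → ∑share≡inv-suc u (d≥1 u)) ⟩
    ∑[ u < suc m ] inv-suc (outdeg D u)       ≡⟨ φ≡sum D ⟨
    φ D                                       ∎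
    where open ≡-Reasoning

  SoleTarget : Fin (suc m) → Set
  SoleTarget v = ∃ λ u → arc D u v ≡ true × outdeg D u ≡ 1

  soleTarget? : ∀ v → Dec (SoleTarget v)
  soleTarget? v = any? (λ u → (arc D u v BoolP.≟ true) ×-dec (outdeg D u ℕ.≟ 1))

  delete-outdeg≥1 : (∀ u → outdeg D u ≥ 1) → ∀ {v} → ¬ SoleTarget v → ∀ x → outdeg (delete D v) x ≥ 1
  delete-outdeg≥1 d≥1 {v} ¬sole x with arc D (punchIn v x) v in xv | outdeg-delete v x
  ... | false | d≡ = subst (_≥ 1) d≡ (d≥1 (punchIn v x))
  ... | true  | d≡ = ℕP.n≢0⇒n>0 (λ d′≡0 → ¬sole (punchIn v x , xv , trans d≡ (cong suc d′≡0)))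

  share-sole : ∀ {u v} → arc D u v ≡ true → outdeg D u ≡ 1 → share u v ≡ inv-suc 1
  share-sole uv du≡1 = trans (share-arc uv) (cong arc-weight du≡1)

  soleTarget⇒inv-suc-1≤gain : ∀ {v} → SoleTarget v → inv-suc 1 ≤ gain v
  soleTarget⇒inv-suc-1≤gain {v} (u , uv , du≡1) =
    subst (_≤ gain v) (share-sole uv du≡1) (term≤sum (λ w → share-nonNeg w v) u)

  soleTarget⇒inv-suc-1<gain : ∀ {v} → SoleTarget v → indeg D v ≢ 1 → inv-suc 1 < gain v
  soleTarget⇒inv-suc-1<gain {v} (u , uv , du≡1) in≢1 = begin-strict
    inv-suc 1         ≡⟨ QP.+-identityʳ (inv-suc 1) ⟨
    inv-suc 1 + 0ℚ    <⟨ QP.+-monoʳ-< (inv-suc 1) 0<rest ⟩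
    inv-suc 1 + rest  ≡⟨ cong (_+ rest) (share-sole uv du≡1) ⟨
    share u v + rest  ≡⟨ sum-remove {i = u} (λ w → share w v) ⟨
    gain v            ∎
    where
    open QP.≤-Reasoning
    rest = ∑[ x < m ] share (punchIn u x) v
    other-in-neighbour : ∃ λ x → arc D (punchIn u x) v ≡ true
    other-in-neighbour = countV≢0⇒∃ (λ x → arc D (punchIn u x) v) λ rest≡0 →
      in≢1 (trans (countV-remove (λ w → arc D w v) u) (cong₂ (λ b c → indicator b ℕ.+ c) uv rest≡0))
    0<rest : 0ℚ < rest
    0<rest = let x , xv = other-in-neighbour in
      QP.<-≤-trans (share-pos xv) (term≤sum (λ y → share-nonNeg (punchIn u y) v) x)

  DegreesOne : Fin (suc m) → Set
  DegreesOne v = indeg D v ≡ 1 × outdeg D v ≡ 1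

  degreesOne? : ∀ v → Dec (DegreesOne v)
  degreesOne? v = (indeg D v ℕ.≟ 1) ×-dec (outdeg D v ℕ.≟ 1)

  soleTarget⇒inv-suc≤gain : ∀ {v} → outdeg D v ≥ 1 → SoleTarget v → inv-suc (outdeg D v) ≤ gain v
  soleTarget⇒inv-suc≤gain dv≥1 sole = QP.≤-trans (inv-suc-anti-≤ dv≥1) (soleTarget⇒inv-suc-1≤gain sole)

  soleTarget⇒inv-suc<gain : ∀ {v} → outdeg D v ≥ 1 → SoleTarget v → ¬ DegreesOne v →
                            inv-suc (outdeg D v) < gain v
  soleTarget⇒inv-suc<gain {v} dv≥1 sole ¬one = case ℕP.m≤n⇒m<n∨m≡n dv≥1 of λ where
    (inj₁ 1<dv) → QP.<-≤-trans (inv-suc-anti-< 1<dv) (soleTarget⇒inv-suc-1≤gain sole)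
    (inj₂ 1≡dv) → subst (λ d → inv-suc d < gain v) 1≡dv
                    (soleTarget⇒inv-suc-1<gain sole (λ in≡1 → ¬one (in≡1 , sym 1≡dv)))

  Deletable : Fin (suc m) → Set
  Deletable v = ¬ SoleTarget v × gain v ≤ inv-suc (outdeg D v)

  deletable? : ∀ v → Dec (Deletable v)
  deletable? v = ¬? (soleTarget? v) ×-dec (gain v QP.≤? inv-suc (outdeg D v))

  undeletable⇒inv-suc≤gain : ∀ {v} → outdeg D v ≥ 1 → ¬ Deletable v → inv-suc (outdeg D v) ≤ gain v
  undeletable⇒inv-suc≤gain {v} dv≥1 ¬del = case soleTarget? v of λ where
    (yes sole) → soleTarget⇒inv-suc≤gain dv≥1 sole
    (no ¬sole) → QP.<⇒≤ (QP.≰⇒> (λ gain≤ → ¬del (¬sole , gain≤)))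

  undeletable⇒inv-suc<gain : ∀ {v} → outdeg D v ≥ 1 → ¬ Deletable v → ¬ DegreesOne v →
                             inv-suc (outdeg D v) < gain v
  undeletable⇒inv-suc<gain {v} dv≥1 ¬del ¬one = case soleTarget? v of λ where
    (yes sole) → soleTarget⇒inv-suc<gain dv≥1 sole ¬one
    (no ¬sole) → QP.≰⇒> (λ gain≤ → ¬del (¬sole , gain≤))

  undeletable⇒degreesOne : (∀ u → outdeg D u ≥ 1) → (∀ u → ¬ Deletable u) → ∀ v → DegreesOne v
  undeletable⇒degreesOne d≥1 ¬del v = decidable-stable (degreesOne? v) ¬¬one
    where
    open QP.≤-Reasoning
    ¬¬one : ¬ ¬ DegreesOne v
    ¬¬one ¬one = QP.<-irrefl refl (begin-strict
      φ D                                  ≡⟨ φ≡sum D ⟩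
      ∑[ u < suc m ] inv-suc (outdeg D u)  <⟨ sum-mono-< (λ u → undeletable⇒inv-suc≤gain (d≥1 u) (¬del u)) v
                                                          (undeletable⇒inv-suc<gain (d≥1 v) (¬del v) ¬one) ⟩
      ∑[ u < suc m ] gain u                ≡⟨ ∑gain≡φ d≥1 ⟩
      φ D                                  ∎)

lemma4p3 : (n : ℕ) (D : Digraph n) → (∀ u → outdeg D u ≥ 1) →
    (Σ (Fin n) λ v → (φ (delete D v) ≤ φ D) × (∀ (u : Fin (pred n)) → outdeg (delete D v) u ≥ 1))
    ⊎ (∀ u → indeg D u ≡ 1 × outdeg D u ≡ 1)
lemma4p3 zero    D outdeg≥1 = inj₂ (λ ())
lemma4p3 (suc m) D outdeg≥1 = case any? (deletable? D) of λ where
  (yes (v , ¬sole , gain≤)) → inj₁ (v , φ-delete-≤ D v gain≤ , delete-outdeg≥1 D outdeg≥1 ¬sole)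
  (no ¬∃del)                → inj₂ (undeletable⇒degreesOne D outdeg≥1 (λ v del → ¬∃del (v , del)))
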